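{- Let $G$ be a graph consisting of $k\ge 2$ connected components $G_1,\dots,G_k$, each containing at least two vertices. Then $h(G)\ge |E(G)|+k$.
   Context: A directed 3-hypergraph $H=(V,F)$ consists of hyperarcs $a,b\to c$ (body $\{a,b\}$ of two distinct vertices, head $c$). The closure $cl_H(S)$ of $S\subseteq V$ is obtained by forward chaining: mark $S$; while some hyperarc $a,b\to c$ has $a,b$ marked and $c$ unmarked, mark $c$. $H$ represents $G=(V,E)$ if for all distinct $x,y$: $(x,y)\in E\Rightarrow cl_H(\{x,y\})=V$ and $(x,y)\notin E\Rightarrow cl_H(\{x,y\})=\{x,y\}$. The hydra number $h(G)$ is the minimum number of hyperarcs of a directed 3-hypergraph on $V$ representing $G$. -}

module Defs where

open import Data.Nat using (ℕ; _+_)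
open import Data.Fin using (Fin; _<_; _<?_)
open import Data.Bool using (Bool; true; false; _∧_)
open import Data.List using (List; length; filter; cartesianProduct)
open import Data.List using (allFin)
open import Data.List.Membership.Propositional using (_∈_)
open import Data.List.Relation.Unary.Unique.Propositional using (Unique)
open import Data.Product using (Σ; ∃; ∃-syntax; _×_; _,_; proj₁; proj₂)
open import Data.Sum using (_⊎_)
open import Relation.Binary.PropositionalEquality using (_≡_; _≢_)
open import Relation.Binary.Construct.Closure.ReflexiveTransitive using (Star)
open import Relation.Nullary.Decidable using (_×-dec_)
open import Data.Bool.Properties using () renaming (_≟_ to _≟ᵇ_)
open import Function.Bundles using (_⇔_)

record Graph (n : ℕ) : Set where
  field
    adj   : Fin n → Fin n → Bool
    sym   : ∀ x y → adj x y ≡ adj y x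
    irrefl : ∀ x → adj x x ≡ false
open Graph public

edgeCount : {n : ℕ} → Graph n → ℕ
edgeCount {n} G =
  length (filter (λ p → (proj₁ p <? proj₂ p) ×-dec (adj G (proj₁ p) (proj₂ p) ≟ᵇ true))
                 (cartesianProduct (allFin n) (allFin n)))

Adj : {n : ℕ} → Graph n → Fin n → Fin n → Set
Adj G x y = adj G x y ≡ true

Connected : {n : ℕ} → Graph n → Fin n → Fin n → Set
Connected G = Star (Adj G)

-- G has exactly k connected components, each containing at least two vertices:
-- a labelling comp : Fin n → Fin k of vertices by components such that two vertices
-- get the same label iff they are connected, and every label class has >= 2 vertices
-- (in particular every label is used, so there are exactly k components).
ComponentsAtLeastTwo : {n : ℕ} → Graph n → ℕ → Set
ComponentsAtLeastTwo {n} G k =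
  Σ (Fin n → Fin k) λ comp →
    (∀ u v → (comp u ≡ comp v) ⇔ Connected G u v) ×
    (∀ (i : Fin k) → ∃[ u ] ∃[ v ] (u ≢ v × comp u ≡ i × comp v ≡ i))

-- A hyperarc a,b → c with body {a,b} of two distinct vertices, stored canonically
-- with a < b so that each hyperarc has a unique representation.
record Hyperarc (n : ℕ) : Set where
  constructor _,_⟶_∣_
  field
    tailA : Fin n
    tailB : Fin n
    head  : Fin n
    ordered : tailA < tailB
open Hyperarc public

record Hypergraph (n : ℕ) : Set where
  field
    arcs   : List (Hyperarc n)
    unique : Unique arcs
open Hypergraph public

size : {n : ℕ} → Hypergraph n → ℕ
size H = length (arcs H)

-- Closure cl_H(S) as the least set containing S and closed under the hyperarcs
-- (exactly the set produced by forward chaining).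
data InClosure {n : ℕ} (H : Hypergraph n) (S : Fin n → Set) : Fin n → Set where
  base : ∀ {x} → S x → InClosure H S x
  fire : ∀ (e : Hyperarc n) → e ∈ arcs H →
         InClosure H S (tailA e) → InClosure H S (tailB e) →
         InClosure H S (head e)

Pair : {n : ℕ} → Fin n → Fin n → Fin n → Set
Pair x y z = z ≡ x ⊎ z ≡ y

Represents : {n : ℕ} → Hypergraph n → Graph n → Set
Represents H G =
  ∀ x y → x ≢ y →
    (adj G x y ≡ true  → ∀ z → InClosure H (Pair x y) z) ×
    (adj G x y ≡ false → ∀ z → InClosure H (Pair x y) z → Pair x y z)

-- Every edge xy needs a hyperarc with body {x,y}: the closure of {x,y} is all of V, so forward
-- chaining must leave {x,y} at some point, and only a hyperarc with body exactly {x,y} can do so.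
-- Each component Gᵢ needs one more: chaining from an edge of Gᵢ must leave Gᵢ, through a hyperarc
-- ab → z with ab an edge of Gᵢ and z outside. Since there is a vertex w ≠ z in z's component,
-- chaining from {a,b} must also leave {a,b,z}; as z is adjacent to neither a nor b, this happens
-- through a second hyperarc with body {a,b} and a head other than z. Distinct edges and distinct
-- components thus claim pairwise distinct hyperarcs.
module Submission where

open import Defs
open import Data.Nat using (ℕ; _+_; _≤_; suc; z≤n; s≤s)
open import Data.Fin using (Fin; _<_; _<?_) renaming (zero to fzero; suc to fsuc)
open import Data.Fin.Properties using (<⇒≢; <-asym; <-irrefl; _≟_)
open import Data.Bool using (true; false)
open import Data.Bool.Properties using () renaming (_≟_ to _≟ᵇ_)
open import Data.Maybe using (Maybe; just; nothing)
open import Data.Maybe.Properties using (just-injective)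
open import Data.List using (List; []; _∷_; _++_; length; map; filter; cartesianProduct; allFin)
  renaming (head to first)
open import Data.List.Properties using (length-++; length-map; length-tabulate)
open import Data.List.Membership.Propositional using (_∈_)
open import Data.List.Membership.Propositional.Properties
  using (∈-∃++; ∈-++⁻; ∈-map⁺; ∈-map⁻; ∈-filter⁺; ∈-filter⁻)
open import Data.List.Relation.Unary.Any using (here; there)
open import Data.List.Relation.Unary.All as All using ()
open import Data.List.Relation.Unary.AllPairs using (_∷_)
open import Data.List.Relation.Unary.Unique.Propositional using (Unique)
import Data.List.Relation.Unary.Unique.Propositional.Properties as Unique
open import Data.Product using (∃; ∃₂; ∃-syntax; _×_; _,_; proj₁; proj₂; uncurry)
open import Data.Sum using (_⊎_; inj₁; inj₂; [_,_])
open import Data.Sum.Properties using (inj₁-injective; inj₂-injective)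
open import Data.Empty using (⊥-elim)
open import Relation.Nullary using (¬_; yes; no)
open import Relation.Nullary.Decidable using (_×-dec_; _⊎-dec_)
open import Relation.Unary using (Pred; Decidable; _⊆_)
open import Relation.Binary.PropositionalEquality as ≡ using (_≡_; _≢_; refl; cong; cong₂; subst₂)
open import Relation.Binary.Construct.Closure.ReflexiveTransitive using (Star; ε; _◅_)
open import Function.Base using (_∘_)
open import Function.Bundles using (_⇔_; Equivalence)

record InjectsInto {A B : Set} (f : A → B) (xs : List A) (ys : List B) : Set where
  field
    maps-into : ∀ {x} → x ∈ xs → f x ∈ ys
    injective : ∀ {x x′} → x ∈ xs → x′ ∈ xs → f x ≡ f x′ → x ≡ x′
open InjectsInto

length-++-∷ : ∀ {B : Set} (ys₁ : List B) (b : B) ys₂ →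
              length (ys₁ ++ b ∷ ys₂) ≡ suc (length (ys₁ ++ ys₂))
length-++-∷ []        b ys₂ = refl
length-++-∷ (y ∷ ys₁) b ys₂ = cong suc (length-++-∷ ys₁ b ys₂)

∈-++-∷-≢ : ∀ {B : Set} (ys₁ : List B) {b v : B} {ys₂} → v ∈ ys₁ ++ b ∷ ys₂ → v ≢ b → v ∈ ys₁ ++ ys₂
∈-++-∷-≢ []        (here v≡b) v≢b = ⊥-elim (v≢b v≡b)
∈-++-∷-≢ []        (there v∈) v≢b = v∈
∈-++-∷-≢ (y ∷ ys₁) (here v≡y) v≢b = here v≡y
∈-++-∷-≢ (y ∷ ys₁) (there v∈) v≢b = there (∈-++-∷-≢ ys₁ v∈ v≢b)

injection⇒length-≤ : ∀ {A B : Set} {f : A → B} {xs ys} →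
                     Unique xs → InjectsInto f xs ys → length xs ≤ length ys
injection⇒length-≤ {xs = []} _ _ = z≤n
injection⇒length-≤ {f = f} {x ∷ xs} (x∉xs ∷ xs!) inj
  with ys₁ , ys₂ , refl ← ∈-∃++ (maps-into inj (here refl))
  rewrite length-++-∷ ys₁ (f x) ys₂ = s≤s (injection⇒length-≤ xs! restricted)
  where
  restricted : InjectsInto f xs (ys₁ ++ ys₂)
  restricted .maps-into x′∈ = ∈-++-∷-≢ ys₁ (maps-into inj (there x′∈))
    λ eq → All.lookup x∉xs x′∈ (≡.sym (injective inj (there x′∈) (here refl) eq))
  restricted .injective x∈ x′∈ = injective inj (there x∈) (there x′∈)

disjoint-injections⇒length-≤ :
  ∀ {A B C : Set} {f : A → C} {g : B → C} {xs ys zs} →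
  Unique xs → Unique ys → InjectsInto f xs zs → InjectsInto g ys zs →
  (∀ {x y} → x ∈ xs → y ∈ ys → f x ≢ g y) →
  length xs + length ys ≤ length zs
disjoint-injections⇒length-≤ {A} {B} {f = f} {g} {xs} {ys} {zs} xs! ys! f-inj g-inj f≢g =
  subst₂ _≤_ length-tagged refl (injection⇒length-≤ tagged! [f,g]-inj)
  where
  tagged : List (A ⊎ B)
  tagged = map inj₁ xs ++ map inj₂ ys

  length-tagged : length tagged ≡ length xs + length ys
  length-tagged = ≡.trans (length-++ (map inj₁ xs)) (cong₂ _+_ (length-map inj₁ xs) (length-map inj₂ ys))

  tagged! : Unique tagged
  tagged! = Unique.++⁺ (Unique.map⁺ inj₁-injective xs!) (Unique.map⁺ inj₂-injective ys!) λ (l , r) →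
    untag (∈-map⁻ inj₁ l) (∈-map⁻ inj₂ r)
    where
    untag : ∀ {t : A ⊎ B} → ∃ (λ x → x ∈ xs × t ≡ inj₁ x) → ¬ ∃ (λ y → y ∈ ys × t ≡ inj₂ y)
    untag (_ , _ , refl) (_ , _ , ())

  ∈-tagged⁻ : ∀ {t} → t ∈ tagged → ∃ (λ x → x ∈ xs × t ≡ inj₁ x) ⊎ ∃ (λ y → y ∈ ys × t ≡ inj₂ y)
  ∈-tagged⁻ t∈ with ∈-++⁻ (map inj₁ xs) t∈
  ... | inj₁ l = inj₁ (∈-map⁻ inj₁ l)
  ... | inj₂ r = inj₂ (∈-map⁻ inj₂ r)

  [f,g]-inj : InjectsInto [ f , g ] tagged zs
  [f,g]-inj .maps-into t∈ with ∈-tagged⁻ t∈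
  ... | inj₁ (_ , x∈ , refl) = maps-into f-inj x∈
  ... | inj₂ (_ , y∈ , refl) = maps-into g-inj y∈
  [f,g]-inj .injective t∈ t′∈ eq with ∈-tagged⁻ t∈ | ∈-tagged⁻ t′∈
  ... | inj₁ (_ , x∈ , refl) | inj₁ (_ , x′∈ , refl) = cong inj₁ (injective f-inj x∈ x′∈ eq)
  ... | inj₂ (_ , y∈ , refl) | inj₂ (_ , y′∈ , refl) = cong inj₂ (injective g-inj y∈ y′∈ eq)
  ... | inj₁ (_ , x∈ , refl) | inj₂ (_ , y′∈ , refl) = ⊥-elim (f≢g x∈ y′∈ eq)
  ... | inj₂ (_ , y∈ , refl) | inj₁ (_ , x′∈ , refl) = ⊥-elim (f≢g x′∈ y∈ (≡.sym eq))

record LeavingArc {n : ℕ} (H : Hypergraph n) (P : Pred (Fin n) _) : Set where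
  field
    arc     : Hyperarc n
    arc∈H   : arc ∈ arcs H
    tailA∈P : P (tailA arc)
    tailB∈P : P (tailB arc)
    head∉P  : ¬ P (head arc)
open LeavingArc

closure-leaves : ∀ {n} {H : Hypergraph n} {S P : Pred (Fin n) _} → Decidable P → S ⊆ P →
                 ∀ {z} → InClosure H S z → ¬ P z → LeavingArc H P
closure-leaves P? S⊆P (base s) z∉P = ⊥-elim (z∉P (S⊆P s))
closure-leaves P? S⊆P (fire e e∈H a∈cl b∈cl) z∉P with P? (tailA e) | P? (tailB e)
... | yes a∈P | yes b∈P = record { arc = e ; arc∈H = e∈H ; tailA∈P = a∈P ; tailB∈P = b∈P ; head∉P = z∉P }
... | no  a∉P | _       = closure-leaves P? S⊆P a∈cl a∉P
... | yes _   | no  b∉P = closure-leaves P? S⊆P b∈cl b∉P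

Pair? : ∀ {n} (x y : Fin n) → Decidable (Pair x y)
Pair? x y z = (z ≟ x) ⊎-dec (z ≟ y)

ordered-in-pair⇒≡ : ∀ {n} {a b x y : Fin n} → a < b → x < y → Pair x y a → Pair x y b → a ≡ x × b ≡ y
ordered-in-pair⇒≡ a<b x<y (inj₁ refl) (inj₁ refl) = ⊥-elim (<-irrefl refl a<b)
ordered-in-pair⇒≡ a<b x<y (inj₁ refl) (inj₂ refl) = refl , refl
ordered-in-pair⇒≡ a<b x<y (inj₂ refl) (inj₁ refl) = ⊥-elim (<-asym a<b x<y)
ordered-in-pair⇒≡ a<b x<y (inj₂ refl) (inj₂ refl) = ⊥-elim (<-irrefl refl a<b)

HasBody : ∀ {n} → Fin n → Fin n → Pred (Hyperarc n) _
HasBody x y e = tailA e ≡ x × tailB e ≡ y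

HasBody? : ∀ {n} (x y : Fin n) → Decidable (HasBody x y)
HasBody? x y e = (tailA e ≟ x) ×-dec (tailB e ≟ y)

firstArcOn : ∀ {n} → Hypergraph n → Fin n → Fin n → Maybe (Hyperarc n)
firstArcOn H x y = first (filter (HasBody? x y) (arcs H))

firstArcOn-sound : ∀ {n} (H : Hypergraph n) {x y a} → firstArcOn H x y ≡ just a → a ∈ arcs H × HasBody x y a
firstArcOn-sound H {x} {y} eq = ∈-filter⁻ (HasBody? x y) (first≡just⇒∈ eq)
  where
  first≡just⇒∈ : ∀ {A : Set} {xs : List A} {a} → first xs ≡ just a → a ∈ xs
  first≡just⇒∈ {xs = _ ∷ _} refl = here refl

firstArcOn-injective : ∀ {n} (H : Hypergraph n) {x y x′ y′ a} →
                       firstArcOn H x y ≡ just a → firstArcOn H x′ y′ ≡ just a → (x , y) ≡ (x′ , y′)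
firstArcOn-injective H eq eq′
  with _ , refl , refl ← firstArcOn-sound H eq
  with _ , refl , refl ← firstArcOn-sound H eq′ = refl

firstArcOn-complete : ∀ {n} (H : Hypergraph n) {x y e} → e ∈ arcs H → HasBody x y e →
                      ∃ λ a → firstArcOn H x y ≡ just a
firstArcOn-complete H {x} {y} e∈H body = ∈⇒first≡just (∈-filter⁺ (HasBody? x y) e∈H body)
  where
  ∈⇒first≡just : ∀ {A : Set} {xs : List A} {e} → e ∈ xs → ∃ λ a → first xs ≡ just a
  ∈⇒first≡just {xs = a ∷ _} _ = a , refl

avoiding : ∀ {n} → Maybe (Hyperarc n) → Hyperarc n → Hyperarc n → Hyperarc n
avoiding nothing  e e′ = e
avoiding (just a) e e′ with head a ≟ head e
... | yes _ = e′
... | no  _ = e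

avoiding-preserves : ∀ {n ℓ} (P : Pred (Hyperarc n) ℓ) m {e e′} → P e → P e′ → P (avoiding m e e′)
avoiding-preserves P nothing  pe pe′ = pe
avoiding-preserves P (just a) {e} pe pe′ with head a ≟ head e
... | yes _ = pe′
... | no  _ = pe

avoiding-≢ : ∀ {n} (m : Maybe (Hyperarc n)) {e e′} → head e ≢ head e′ → m ≢ just (avoiding m e e′)
avoiding-≢ (just a) {e} {e′} e≢e′ m≡ with head a ≟ head e | just-injective m≡
... | yes a≡e | refl = e≢e′ (≡.sym a≡e)
... | no  a≢e | refl = a≢e refl

Adj-sym : ∀ {n} (G : Graph n) {x y} → Adj G x y → Adj G y x
Adj-sym G {x} {y} xy = ≡.trans (sym G y x) xy

module Representing {n : ℕ} {G : Graph n} {H : Hypergraph n} (rep : Represents H G) where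

  edge-closure-full : ∀ {x y} → x ≢ y → Adj G x y → ∀ z → InClosure H (Pair x y) z
  edge-closure-full {x} {y} x≢y = proj₁ (rep x y x≢y)

  arc-leaving-body⇒edge : ∀ {e} → e ∈ arcs H → ¬ Pair (tailA e) (tailB e) (head e) → Adj G (tailA e) (tailB e)
  arc-leaving-body⇒edge {e} e∈H head∉body with adj G (tailA e) (tailB e) in ab
  ... | true  = refl
  ... | false = ⊥-elim (head∉body (proj₂ (rep (tailA e) (tailB e) (<⇒≢ (ordered e))) ab (head e)
                  (fire e e∈H (base (inj₁ refl)) (base (inj₂ refl)))))

  edge-has-arc : ∀ {x y w} → x < y → Adj G x y → ¬ Pair x y w → ∃ λ e → e ∈ arcs H × HasBody x y e
  edge-has-arc {x} {y} {w} x<y xy w∉xy = arc l , arc∈H l ,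
    ordered-in-pair⇒≡ (ordered (arc l)) x<y (tailA∈P l) (tailB∈P l)
    where
    l = closure-leaves (Pair? x y) (λ p → p) (edge-closure-full (<⇒≢ x<y) xy w) w∉xy

  -- Chaining from {a,b} must leave {a,b,z}; an arc doing so has an edge as body, which must be ab.
  second-arc : ∀ {e w} → e ∈ arcs H →
    ¬ Pair (tailA e) (tailB e) (head e) →
    (∀ {c} → Pair (tailA e) (tailB e) c → ¬ Adj G c (head e)) →
    ¬ (Pair (tailA e) (tailB e) w ⊎ w ≡ head e) →
    ∃ λ e′ → e′ ∈ arcs H × HasBody (tailA e) (tailB e) e′ × head e′ ≢ head e
  second-arc {e} {w} e∈H z∉ab z≁ab w∉abz =
    arc l , arc∈H l , ordered-in-pair⇒≡ (ordered (arc l)) (ordered e) a′∈ab b′∈ab , head∉P l ∘ inj₂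
    where
    a = tailA e
    b = tailB e
    z = head e
    Q : Pred (Fin n) _
    Q c = Pair a b c ⊎ c ≡ z
    l = closure-leaves (λ c → Pair? a b c ⊎-dec (c ≟ z)) inj₁
          (edge-closure-full (<⇒≢ (ordered e)) (arc-leaving-body⇒edge e∈H z∉ab) w) w∉abz
    a′b′-edge : Adj G (tailA (arc l)) (tailB (arc l))
    a′b′-edge = arc-leaving-body⇒edge (arc∈H l) λ where
      (inj₁ h≡a′) → head∉P l (≡.subst Q (≡.sym h≡a′) (tailA∈P l))
      (inj₂ h≡b′) → head∉P l (≡.subst Q (≡.sym h≡b′) (tailB∈P l))
    edge-in-Q⇒in-ab : ∀ {s t} → Q s → Q t → s ≢ t → Adj G s t → Pair a b s × Pair a b t
    edge-in-Q⇒in-ab (inj₁ s∈) (inj₁ t∈) _   _  = s∈ , t∈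
    edge-in-Q⇒in-ab (inj₁ s∈) (inj₂ refl) _ st = ⊥-elim (z≁ab s∈ st)
    edge-in-Q⇒in-ab (inj₂ refl) (inj₁ t∈) _ st = ⊥-elim (z≁ab t∈ (Adj-sym G st))
    edge-in-Q⇒in-ab (inj₂ refl) (inj₂ refl) s≢t _ = ⊥-elim (s≢t refl)
    a′∈ab = proj₁ (edge-in-Q⇒in-ab (tailA∈P l) (tailB∈P l) (<⇒≢ (ordered (arc l))) a′b′-edge)
    b′∈ab = proj₂ (edge-in-Q⇒in-ab (tailA∈P l) (tailB∈P l) (<⇒≢ (ordered (arc l))) a′b′-edge)

another-element : ∀ {k} → 2 ≤ k → (i : Fin k) → ∃ λ j → j ≢ i
another-element (s≤s (s≤s _)) fzero    = fsuc fzero , λ ()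
another-element (s≤s (s≤s _)) (fsuc i) = fzero , λ ()

Star-≢⇒step : ∀ {A : Set} {R : A → A → Set} {u v} → Star R u v → u ≢ v → ∃ (R u)
Star-≢⇒step ε        u≢v = ⊥-elim (u≢v refl)
Star-≢⇒step (uw ◅ _) _   = _ , uw

IsEdgePair : ∀ {n} → Graph n → Pred (Fin n × Fin n) _
IsEdgePair G (x , y) = x < y × Adj G x y

isEdgePair? : ∀ {n} (G : Graph n) → Decidable (IsEdgePair G)
isEdgePair? G p = (proj₁ p <? proj₂ p) ×-dec (adj G (proj₁ p) (proj₂ p) ≟ᵇ true)

-- edgeCount G is definitionally length (edgePairs G).
edgePairs : ∀ {n} → Graph n → List (Fin n × Fin n)
edgePairs {n} G = filter (isEdgePair? G) (cartesianProduct (allFin n) (allFin n))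

edgePairs-unique : ∀ {n} (G : Graph n) → Unique (edgePairs G)
edgePairs-unique {n} G =
  Unique.filter⁺ (isEdgePair? G) (Unique.cartesianProduct⁺ (Unique.allFin⁺ n) (Unique.allFin⁺ n))

∈-edgePairs⁻ : ∀ {n} {G : Graph n} {p} → p ∈ edgePairs G → IsEdgePair G p
∈-edgePairs⁻ {n} {G} p∈ = proj₂ (∈-filter⁻ (isEdgePair? G) {xs = cartesianProduct (allFin n) (allFin n)} p∈)

module Components {n k : ℕ} {G : Graph n} {H : Hypergraph n} (rep : Represents H G) (2≤k : 2 ≤ k)
  (comp : Fin n → Fin k) (comp≡⇔connected : ∀ u v → (comp u ≡ comp v) ⇔ Connected G u v)
  (two-in : ∀ i → ∃[ u ] ∃[ v ] (u ≢ v × comp u ≡ i × comp v ≡ i)) where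

  open Representing {G = G} {H = H} rep

  adjacent⇒same-component : ∀ {x y} → Adj G x y → comp x ≡ comp y
  adjacent⇒same-component {x} {y} xy = Equivalence.from (comp≡⇔connected x y) (xy ◅ ε)

  vertex-outside : ∀ i → ∃ λ w → comp w ≢ i
  vertex-outside i
    with j , j≢i ← another-element 2≤k i
    with u , _ , _ , refl , _ ← two-in j = u , j≢i

  another-vertex-in-component : ∀ z → ∃ λ w → w ≢ z × comp w ≡ comp z
  another-vertex-in-component z with two-in (comp z)
  ... | u , v , u≢v , cu , cv with u ≟ z
  ... | yes refl = v , u≢v ∘ ≡.sym , cv
  ... | no  u≢z  = u , u≢z , cu

  component-has-edge : ∀ i → ∃₂ λ u w → comp u ≡ i × Adj G u w
  component-has-edge i
    with u , v , u≢v , cu , cv ← two-in i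
    with w , uw ← Star-≢⇒step (Equivalence.to (comp≡⇔connected u v) (≡.trans cu (≡.sym cv))) u≢v
    = u , w , cu , uw

  component-leaving-arc : ∀ i → LeavingArc H (λ z → comp z ≡ i)
  component-leaving-arc i with u , w , cu , uw ← component-has-edge i =
    closure-leaves (λ z → comp z ≟ i) uw-in-i (edge-closure-full u≢w uw (proj₁ (vertex-outside i)))
      (proj₂ (vertex-outside i))
    where
    u≢w : u ≢ w
    u≢w refl with () ← ≡.trans (≡.sym (irrefl G u)) uw
    uw-in-i : Pair u w ⊆ (λ z → comp z ≡ i)
    uw-in-i (inj₁ refl) = cu
    uw-in-i (inj₂ refl) = ≡.trans (≡.sym (adjacent⇒same-component uw)) cu

  record DoubledEdge (i : Fin k) : Set where
    field
      arc₁ arc₂    : Hyperarc n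
      arc₁∈H       : arc₁ ∈ arcs H
      arc₂∈H       : arc₂ ∈ arcs H
      in-component : comp (tailA arc₁) ≡ i
      same-body    : HasBody (tailA arc₁) (tailB arc₁) arc₂
      heads-differ : head arc₁ ≢ head arc₂

    -- The arc charged to component i: whichever of arc₁, arc₂ is not the one charged to its edge.
    spare : Hyperarc n
    spare = avoiding (firstArcOn H (tailA arc₁) (tailB arc₁)) arc₁ arc₂

    spare∈H : spare ∈ arcs H
    spare∈H = avoiding-preserves (_∈ arcs H) (firstArcOn H (tailA arc₁) (tailB arc₁)) arc₁∈H arc₂∈H

    spare-body : HasBody (tailA arc₁) (tailB arc₁) spare
    spare-body = avoiding-preserves (HasBody (tailA arc₁) (tailB arc₁)) (firstArcOn H (tailA arc₁) (tailB arc₁))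
                   (refl , refl) same-body

    spare-in-component : comp (tailA spare) ≡ i
    spare-in-component = ≡.trans (cong comp (proj₁ spare-body)) in-component

    firstArcOn≢spare : ∀ x y → firstArcOn H x y ≢ just spare
    firstArcOn≢spare x y eq with _ , refl , refl ← firstArcOn-sound H eq =
      avoiding-≢ (firstArcOn H (tailA arc₁) (tailB arc₁)) heads-differ
        (subst₂ (λ x y → firstArcOn H x y ≡ just spare) (proj₁ spare-body) (proj₂ spare-body) eq)

  leaving-arc⇒doubled-edge : ∀ {i} → LeavingArc H (λ z → comp z ≡ i) → DoubledEdge i
  leaving-arc⇒doubled-edge {i} l = doubled (another-vertex-in-component z)
    where
    a = tailA (arc l)
    b = tailB (arc l)
    z = head (arc l)
    in-i : Pair a b ⊆ (λ c → comp c ≡ i)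
    in-i (inj₁ refl) = tailA∈P l
    in-i (inj₂ refl) = tailB∈P l
    z≁ab : ∀ {c} → Pair a b c → ¬ Adj G c z
    z≁ab c∈ab cz = head∉P l (≡.trans (≡.sym (adjacent⇒same-component cz)) (in-i c∈ab))
    w∉abz : ∀ {w} → w ≢ z → comp w ≡ comp z → ¬ (Pair a b w ⊎ w ≡ z)
    w∉abz _   cw (inj₁ w∈ab) = head∉P l (≡.trans (≡.sym cw) (in-i w∈ab))
    w∉abz w≢z _  (inj₂ w≡z)  = w≢z w≡z
    doubled : (∃ λ w → w ≢ z × comp w ≡ comp z) → DoubledEdge i
    doubled (w , w≢z , cw)
      with e′ , e′∈H , body , e′≢z ← second-arc (arc∈H l) (head∉P l ∘ in-i) z≁ab (w∉abz w≢z cw)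
      = record { arc₁ = arc l ; arc₂ = e′ ; arc₁∈H = arc∈H l ; arc₂∈H = e′∈H ; in-component = tailA∈P l
               ; same-body = body ; heads-differ = e′≢z ∘ ≡.sym }

  doubled-edge : ∀ i → DoubledEdge i
  doubled-edge i = leaving-arc⇒doubled-edge (component-leaving-arc i)

  module Doubled (i : Fin k) = DoubledEdge (doubled-edge i)
  open Doubled using (spare; spare∈H; spare-in-component; firstArcOn≢spare)

  edge-has-first-arc : ∀ {x y} → x < y → Adj G x y → ∃ λ a → firstArcOn H x y ≡ just a
  edge-has-first-arc {x} {y} x<y xy =
    let e , e∈H , body = edge-has-arc x<y xy w∉xy in firstArcOn-complete H e∈H body
    where
    w∉xy : ¬ Pair x y (proj₁ (vertex-outside (comp x)))
    w∉xy (inj₁ w≡x) = proj₂ (vertex-outside (comp x)) (cong comp w≡x)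
    w∉xy (inj₂ w≡y) = proj₂ (vertex-outside (comp x))
      (≡.trans (cong comp w≡y) (≡.sym (adjacent⇒same-component xy)))

  edge-arc : ∀ {p} → p ∈ edgePairs G → ∃ λ a → uncurry (firstArcOn H) p ≡ just a
  edge-arc p∈ = uncurry edge-has-first-arc (∈-edgePairs⁻ {G = G} p∈)

  edge-injection : InjectsInto (uncurry (firstArcOn H)) (edgePairs G) (map just (arcs H))
  edge-injection .maps-into p∈ with a , eq ← edge-arc p∈ rewrite eq =
    ∈-map⁺ just (proj₁ (firstArcOn-sound H eq))
  edge-injection .injective p∈ _ eq with a , eqa ← edge-arc p∈ =
    firstArcOn-injective H eqa (≡.trans (≡.sym eq) eqa)

  spare-injection : InjectsInto (just ∘ spare) (allFin k) (map just (arcs H))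
  spare-injection .maps-into {i} _ = ∈-map⁺ just (spare∈H i)
  spare-injection .injective {i} {j} _ _ eq = begin
    i                        ≡⟨ ≡.sym (spare-in-component i) ⟩
    comp (tailA (spare i))   ≡⟨ cong (comp ∘ tailA) (just-injective eq) ⟩
    comp (tailA (spare j))   ≡⟨ spare-in-component j ⟩
    j                        ∎
    where open ≡.≡-Reasoning

  size-bound : edgeCount G + k ≤ size H
  size-bound = subst₂ _≤_ (cong (edgeCount G +_) (length-tabulate (λ i → i))) (length-map just (arcs H))
    (disjoint-injections⇒length-≤ (edgePairs-unique G) (Unique.allFin⁺ k) edge-injection spare-injection
      λ {p} {i} _ _ → firstArcOn≢spare i (proj₁ p) (proj₂ p))

proposition4p3 : ∀ (n : ℕ) (G : Graph n) (k : ℕ) → 2 ≤ k →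
    ComponentsAtLeastTwo G k →
    ∀ (H : Hypergraph n) → Represents H G → edgeCount G + k ≤ size H
proposition4p3 n G k 2≤k (comp , comp≡⇔connected , two-in) H rep =
  Components.size-bound {G = G} {H = H} rep 2≤k comp comp≡⇔connected two-in
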